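{- Let $\mathfrak{n}=\mathfrak{n}^0\oplus\mathfrak{n}^1$ be a Hoffman graph such that $\mathfrak{n}^0\in\mathcal{O}\setminus\{\mathfrak{h}_2\}$ and $\mathfrak{n}^1$ is non-empty, and suppose the slim subgraph of $\mathfrak{n}$ is connected. Then for every $x\in V_s(\mathfrak{n}^0)$, the slim subgraph of $\mathfrak{n}-x$ is connected.
   Context: A Hoffman graph $\mathfrak{h}=(H,\mu)$ is a finite simple graph $H$ with labeling $\mu:V(H)\to\{f,s\}$ such that every fat vertex (label $f$) has a slim neighbour (label $s$), and fat vertices are pairwise non-adjacent. $V_s,V_f$ denote slim/fat vertex sets, $N^f_{\mathfrak{h}}(x)$ the fat neighbours of $x$. A Hoffman subgraph is an induced subgraph with restricted labeling; $\mathfrak{n}-x$ is the Hoffman subgraph induced by $V(\mathfrak{n})\setminus\{x\}$. The slim subgraph is the graph induced on $V_s$. Sum: $\mathfrak{h}=\mathfrak{h}^1\oplus\mathfrak{h}^2$ for Hoffman subgraphs means (i) $V(\mathfrak{h})=V(\mathfrak{h}^1)\cup V(\mathfrak{h}^2)$; (ii) $V_s(\mathfrak{h})=V_s(\mathfrak{h}^1)\sqcup V_s(\mathfrak{h}^2)$; (iii) $N^f_{\mathfrak{h}^i}(x)=N^f_{\mathfrak{h}}(x)$ for $x\in V_s(\mathfrak{h}^i)$; (iv) for $x\in V_s(\mathfrak{h}^1)$, $y\in V_s(\mathfrak{h}^2)$: $|N^f_{\mathfrak{h}}(x)\cap N^f_{\mathfrak{h}}(y)|\le1$ with equality iff $x,y$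 adjacent. Indecomposable: not a sum of two non-empty Hoffman subgraphs. Fat: every slim vertex has a fat neighbour. $\mathfrak{h}_2$: one slim vertex adjacent to two fat vertices. $\mathcal{O}$: $\mathfrak{h}_2$ together with all indecomposable fat Hoffman graphs with at least two slim vertices and exactly one fat vertex (membership up to isomorphism). -}

module Defs where

open import Data.Nat using (ℕ; _≤_)
open import Data.Bool using (Bool; true; false; _∧_; if_then_else_)
open import Data.Fin using (Fin; zero; suc)
open import Data.Fin.Subset using (Subset; _∈_; _∉_; _⊆_; ∣_∣; ⊤)
open import Data.Fin.Subset.Properties using (_∈?_)
open import Data.Vec using (tabulate)
open import Data.Product using (Σ; ∃; _×_; _,_)
open import Data.Sum using (_⊎_)
open import Data.Empty using (⊥)
open import Relation.Nullary using (¬_; Dec; yes; no)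
open import Relation.Nullary.Decidable using (⌊_⌋)
open import Relation.Binary.PropositionalEquality using (_≡_; _≢_)
open import Function.Bundles using (_⇔_)

data Label : Set where
  f s : Label

isFat : Label → Bool
isFat f = true
isFat s = false

record HoffmanGraph (n : ℕ) : Set where
  field
    adj        : Fin n → Fin n → Bool
    label      : Fin n → Label
    adj-irrefl : ∀ x → adj x x ≡ false
    adj-sym    : ∀ x y → adj x y ≡ adj y x
    fat-indep  : ∀ x y → label x ≡ f → label y ≡ f → adj x y ≡ false
    fat-slim   : ∀ x → label x ≡ f → ∃ λ y → adj x y ≡ true × label y ≡ s

open HoffmanGraph public

module _ {n : ℕ} (G : HoffmanGraph n) where

  Adj : Fin n → Fin n → Set
  Adj x y = adj G x y ≡ true

  Slim : Fin n → Set
  Slim x = label G x ≡ s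

  Fat : Fin n → Set
  Fat x = label G x ≡ f

  -- The induced subgraph on S (with restricted labelling) is a Hoffman
  -- graph, i.e. a Hoffman subgraph of G.  (Simplicity and independence of
  -- fat vertices are inherited; only the slim-neighbour condition remains.)
  IsHoffmanSubgraph : Subset n → Set
  IsHoffmanSubgraph S =
    ∀ x → x ∈ S → Fat x → ∃ λ y → y ∈ S × Slim y × Adj x y

  NonEmpty : Subset n → Set
  NonEmpty S = ∃ λ x → x ∈ S

  FatNbr : Subset n → Fin n → Fin n → Set
  FatNbr S x y = y ∈ S × Fat y × Adj x y

  commonFat : Subset n → Fin n → Fin n → Subset n
  commonFat S x y =
    tabulate λ z → ⌊ z ∈? S ⌋ ∧ isFat (label G z) ∧ adj G x z ∧ adj G y z

  slimSet : Subset n → Subset n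
  slimSet S = tabulate λ z → ⌊ z ∈? S ⌋ ∧ (if isFat (label G z) then false else true)

  fatSet : Subset n → Subset n
  fatSet S = tabulate λ z → ⌊ z ∈? S ⌋ ∧ isFat (label G z)

  IsSum : Subset n → Subset n → Subset n → Set
  IsSum S S1 S2 =
    IsHoffmanSubgraph S1 × IsHoffmanSubgraph S2 × S1 ⊆ S × S2 ⊆ S
    -- (i) V = V1 ∪ V2
    × (∀ x → x ∈ S → x ∈ S1 ⊎ x ∈ S2)
    -- (ii) V_s = V_s1 ⊔ V_s2 (disjoint; covering follows from (i))
    × (∀ x → Slim x → x ∈ S1 → x ∉ S2)
    -- (iii) N^f_{S_i}(x) = N^f_S(x) for slim x in S_i
    × (∀ x → x ∈ S1 → Slim x → ∀ y → FatNbr S x y → y ∈ S1)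
    × (∀ x → x ∈ S2 → Slim x → ∀ y → FatNbr S x y → y ∈ S2)
    -- (iv)
    × (∀ x y → x ∈ S1 → Slim x → y ∈ S2 → Slim y →
         (∣ commonFat S x y ∣ ≤ 1) × (∣ commonFat S x y ∣ ≡ 1 ⇔ Adj x y))

  Indecomposable : Subset n → Set
  Indecomposable S =
    ¬ (Σ (Subset n) λ S1 → Σ (Subset n) λ S2 →
         NonEmpty S1 × NonEmpty S2 × IsSum S S1 S2)

  IsFat : Subset n → Set
  IsFat S = ∀ x → x ∈ S → Slim x → ∃ λ y → FatNbr S x y

  data SlimReach (S : Subset n) (x : Fin n) : Fin n → Set where
    here : SlimReach S x x
    step : ∀ {y z} → SlimReach S x y → Adj y z → z ∈ S → Slim z →
           SlimReach S x z

  SlimConnected : Subset n → Set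
  SlimConnected S =
    ∀ x y → x ∈ S → Slim x → y ∈ S → Slim y → SlimReach S x y

Iso : ∀ {n m} → HoffmanGraph n → Subset n → HoffmanGraph m → Subset m → Set
Iso {n} {m} G S G' S' =
  Σ (Fin n → Fin m) λ φ → Σ (Fin m → Fin n) λ ψ →
    (∀ x → x ∈ S → φ x ∈ S') × (∀ y → y ∈ S' → ψ y ∈ S)
    × (∀ x → x ∈ S → ψ (φ x) ≡ x) × (∀ y → y ∈ S' → φ (ψ y) ≡ y)
    × (∀ x → x ∈ S → label G' (φ x) ≡ label G x)
    × (∀ x y → x ∈ S → y ∈ S → adj G' (φ x) (φ y) ≡ adj G x y)

h2-adj : Fin 3 → Fin 3 → Bool
h2-adj zero (suc zero) = true
h2-adj zero (suc (suc zero)) = true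
h2-adj (suc zero) zero = true
h2-adj (suc (suc zero)) zero = true
h2-adj _ _ = false

h2-label : Fin 3 → Label
h2-label zero = s
h2-label (suc _) = f

h2 : HoffmanGraph 3
h2 = record
  { adj = h2-adj
  ; label = h2-label
  ; adj-irrefl = irr
  ; adj-sym = sy
  ; fat-indep = ind
  ; fat-slim = fs
  }
  where
  open import Relation.Binary.PropositionalEquality using (refl)
  irr : ∀ x → h2-adj x x ≡ false
  irr zero = refl
  irr (suc zero) = refl
  irr (suc (suc zero)) = refl
  sy : ∀ x y → h2-adj x y ≡ h2-adj y x
  sy zero zero = refl
  sy zero (suc zero) = refl
  sy zero (suc (suc zero)) = refl
  sy (suc zero) zero = refl
  sy (suc zero) (suc zero) = refl
  sy (suc zero) (suc (suc zero)) = refl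
  sy (suc (suc zero)) zero = refl
  sy (suc (suc zero)) (suc zero) = refl
  sy (suc (suc zero)) (suc (suc zero)) = refl
  ind : ∀ x y → h2-label x ≡ f → h2-label y ≡ f → h2-adj x y ≡ false
  ind zero _ ()
  ind (suc _) zero _ ()
  ind (suc zero) (suc zero) _ _ = refl
  ind (suc zero) (suc (suc zero)) _ _ = refl
  ind (suc (suc zero)) (suc zero) _ _ = refl
  ind (suc (suc zero)) (suc (suc zero)) _ _ = refl
  fs : ∀ x → h2-label x ≡ f → ∃ λ y → h2-adj x y ≡ true × h2-label y ≡ s
  fs zero ()
  fs (suc zero) _ = zero , refl , refl
  fs (suc (suc zero)) _ = zero , refl , refl

In𝒪 : ∀ {n} → HoffmanGraph n → Subset n → Set
In𝒪 G S =
  Iso G S h2 ⊤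
  ⊎ (Indecomposable G S × IsFat G S × 2 ≤ ∣ slimSet G S ∣ × ∣ fatSet G S ∣ ≡ 1)

module Submission where

-- Write 𝔫 = 𝔫⁰ ⊕ 𝔫¹ with 𝔫⁰ ∈ 𝒪 ∖ {𝔥₂}; then 𝔫⁰ is fat
-- and has exactly one fat vertex z and at least two slim vertices.
--   * Transfer: if a slim u ∈ 𝔫⁰ is adjacent to a slim v ∈ 𝔫¹, they share a
--     fat vertex, which lies in 𝔫⁰ and hence is z; every slim u' ∈ 𝔫⁰ is
--     adjacent to z, so u' and v share z as well and are adjacent by (iv).
--   * Since the slim graph is connected and 𝔫¹ has a slim vertex, some slim
--     walk crosses from 𝔫⁰ to 𝔫¹; by transfer, the removed vertex x has a
--     slim neighbour w ∈ 𝔫¹, and w is adjacent to every slim vertex of 𝔫⁰.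
--   * Vertex removal: a slim walk from w that meets x can be rerouted as soon
--     as w reaches every slim neighbour z of x while avoiding x.  If z ∈ 𝔫⁰
--     then w ~ z; if z ∈ 𝔫¹ then z ~ x' for a second slim x' ∈ 𝔫⁰ (transfer),
--     and w ~ x'.  Hence every slim vertex of 𝔫 - x is joined to w.

open import Defs
open import Data.Nat using (ℕ; _≤_; _<_)
open import Data.Nat.Properties using (≤-antisym; ≤-reflexive; ≤-trans; ≤-<-trans; <-irrefl)
open import Data.Bool using (Bool; true; false; T; if_then_else_)
open import Data.Bool.Properties using (T-≡; T-∧)
open import Data.Unit using (tt)
open import Data.Fin using (Fin)
open import Data.Fin.Properties using (_≟_; any?)
open import Data.Fin.Subset using (Subset; Nonempty; _∈_; _∉_; _⊆_; ∣_∣; ⊤; ∁; ⁅_⁆)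
open import Data.Fin.Subset.Properties using (_∈?_; ∈⊤; nonempty?; Empty-unique; ∣⊥∣≡0; x∈⁅x⁆; x∈⁅y⁆⇒x≡y; ∣⁅x⁆∣≡1; p⊆q⇒∣p∣≤∣q∣; x∈p∧x≢y⇒x∈p-y; x∈p⇒∣p-x∣<∣p∣; x≢y⇒x∉⁅y⁆; x∉⁅y⁆⇒x≢y; x∉p⇒x∈∁p; x∈∁p⇒x∉p)
open import Data.Vec using (tabulate)
open import Data.Vec.Properties using (lookup∘tabulate; []=⇒lookup; lookup⇒[]=)
open import Data.Product using (∃; _×_; _,_)
open import Data.Sum using (_⊎_; inj₁; inj₂)
open import Data.Empty using (⊥-elim)
open import Relation.Nullary using (¬_; yes; no; ¬?)
open import Relation.Nullary.Decidable using (⌊_⌋; _×-dec_; toWitness; fromWitness)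
open import Relation.Binary.PropositionalEquality using (_≡_; _≢_; refl; sym; trans; subst; cong)
open import Function.Bundles using (_⇔_; mk⇔; Equivalence)

open Equivalence using (to; from)

∈-tabulate : ∀ {n} {g : Fin n → Bool} {x : Fin n} → x ∈ tabulate g ⇔ T (g x)
∈-tabulate {g = g} {x} = mk⇔
  (λ x∈ → from T-≡ (trans (sym (lookup∘tabulate g x)) ([]=⇒lookup x∈)))
  (λ gx → lookup⇒[]= x (tabulate g) (trans (lookup∘tabulate g x) (to T-≡ gx)))

isFat⇔fat : ∀ {l : Label} → T (isFat l) ⇔ (l ≡ f)
isFat⇔fat {f} = mk⇔ (λ _ → refl) (λ _ → tt)
isFat⇔fat {s} = mk⇔ (λ ()) (λ ())

notFat⇒slim : ∀ {l : Label} → T (if isFat l then false else true) → l ≡ s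
notFat⇒slim {s} _ = refl

module _ {n} (G : HoffmanGraph n) {S : Subset n} where

  commonFat⁺ : ∀ {u v z} → z ∈ S → Fat G z → Adj G u z → Adj G v z →
               z ∈ commonFat G S u v
  commonFat⁺ {u} {z = z} z∈S fz uz vz = from ∈-tabulate
    (from (T-∧ {⌊ z ∈? S ⌋}) (fromWitness z∈S ,
      from (T-∧ {isFat (label G z)}) (from isFat⇔fat fz ,
        from (T-∧ {adj G u z}) (from T-≡ uz , from T-≡ vz))))

  commonFat⁻ : ∀ {u v z} → z ∈ commonFat G S u v → Fat G z × Adj G u z × Adj G v z
  commonFat⁻ {u} {z = z} z∈ =
    let _ , fat∧uz∧vz = to (T-∧ {⌊ z ∈? S ⌋}) (to ∈-tabulate z∈)
        fat , uz∧vz   = to (T-∧ {isFat (label G z)}) fat∧uz∧vz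
        uz , vz       = to (T-∧ {adj G u z}) uz∧vz
    in to isFat⇔fat fat , to T-≡ uz , to T-≡ vz

  fatSet⁺ : ∀ {z} → z ∈ S → Fat G z → z ∈ fatSet G S
  fatSet⁺ {z} z∈S fz =
    from ∈-tabulate (from (T-∧ {⌊ z ∈? S ⌋}) (fromWitness z∈S , from isFat⇔fat fz))

  slimSet⁻ : ∀ {z} → z ∈ slimSet G S → z ∈ S × Slim G z
  slimSet⁻ {z} z∈ =
    let z∈S , notFat = to (T-∧ {⌊ z ∈? S ⌋}) (to ∈-tabulate z∈)
    in toWitness z∈S , notFat⇒slim notFat

∈⇒1≤∣p∣ : ∀ {n} {p : Subset n} {x} → x ∈ p → 1 ≤ ∣ p ∣
∈⇒1≤∣p∣ {p = p} {x} x∈p = ≤-trans (≤-reflexive (sym (∣⁅x⁆∣≡1 x))) (p⊆q⇒∣p∣≤∣q∣ ⁅x⁆⊆p)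
  where
  ⁅x⁆⊆p : ⁅ x ⁆ ⊆ p
  ⁅x⁆⊆p y∈ = subst (_∈ p) (sym (x∈⁅y⁆⇒x≡y x y∈)) x∈p

module _ {n : ℕ} {p : Subset n} where

  1≤∣p∣⇒nonempty : 1 ≤ ∣ p ∣ → Nonempty p
  1≤∣p∣⇒nonempty 1≤ with nonempty? p
  ... | yes ne = ne
  ... | no empty with subst (1 ≤_) (trans (cong ∣_∣ (Empty-unique empty)) (∣⊥∣≡0 n)) 1≤
  ...   | ()

  ∣p∣≡1⇒unique : ∣ p ∣ ≡ 1 → ∀ {x y} → x ∈ p → y ∈ p → x ≡ y
  ∣p∣≡1⇒unique size {x} {y} x∈p y∈p with x ≟ y
  ... | yes x≡y = x≡y
  ... | no x≢y = ⊥-elim (<-irrefl refl (subst (1 <_) size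
        (≤-<-trans (∈⇒1≤∣p∣ (x∈p∧x≢y⇒x∈p-y y∈p (λ y≡x → x≢y (sym y≡x))))
                   (x∈p⇒∣p-x∣<∣p∣ x∈p))))

  2≤∣p∣⇒another : 2 ≤ ∣ p ∣ → ∀ x → ∃ λ y → y ∈ p × y ≢ x
  2≤∣p∣⇒another 2≤ x with any? (λ y → (y ∈? p) ×-dec ¬? (y ≟ x))
  ... | yes found = found
  ... | no none = ⊥-elim (<-irrefl refl (≤-trans 2≤ (≤-trans (p⊆q⇒∣p∣≤∣q∣ p⊆⁅x⁆) (≤-reflexive (∣⁅x⁆∣≡1 x)))))
    where
    p⊆⁅x⁆ : p ⊆ ⁅ x ⁆
    p⊆⁅x⁆ {y} y∈p with y ≟ x
    ... | yes refl = x∈⁅x⁆ x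
    ... | no y≢x = ⊥-elim (none (y , y∈p , y≢x))

∈∁⁅⁆ : ∀ {n} {x y : Fin n} → y ≢ x → y ∈ ∁ ⁅ x ⁆
∈∁⁅⁆ y≢x = x∉p⇒x∈∁p (x≢y⇒x∉⁅y⁆ y≢x)

∈∁⁅⁆⇒≢ : ∀ {n} {x y : Fin n} → y ∈ ∁ ⁅ x ⁆ → y ≢ x
∈∁⁅⁆⇒≢ y∈ = x∉⁅y⁆⇒x≢y (x∈∁p⇒x∉p y∈)

module _ {n} (G : HoffmanGraph n) where

  Adj-sym : ∀ {a b} → Adj G a b → Adj G b a
  Adj-sym {a} {b} ab = trans (adj-sym G b a) ab

  Adj⇒≢ : ∀ {a b} → Adj G a b → b ≢ a
  Adj⇒≢ {a} aa refl with () ← trans (sym (adj-irrefl G a)) aa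

  slim-member : ∀ {S} → IsHoffmanSubgraph G S → NonEmpty G S →
                ∃ λ y → y ∈ S × Slim G y
  slim-member hoffman (y , y∈S) with label G y in label≡
  ... | s = y , y∈S , label≡
  ... | f with hoffman y y∈S label≡
  ...   | z , z∈S , zs , _ = z , z∈S , zs

module _ {n} (G : HoffmanGraph n) {S : Subset n} where

  walk-end : ∀ {a b} → SlimReach G S a b → a ∈ S → Slim G a → b ∈ S × Slim G b
  walk-end here a∈S as = a∈S , as
  walk-end (step _ _ b∈S bs) _ _ = b∈S , bs

  _++ʷ_ : ∀ {a b c} → SlimReach G S a b → SlimReach G S b c → SlimReach G S a c
  r ++ʷ here = r
  r ++ʷ step r' e c∈S cs = step (r ++ʷ r') e c∈S cs

  reverseʷ : ∀ {a b} → SlimReach G S a b → a ∈ S → Slim G a → SlimReach G S b a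
  reverseʷ here _ _ = here
  reverseʷ (step {y} r yb _ _) a∈S as with walk-end r a∈S as
  ... | y∈S , ys = step here (Adj-sym G yb) y∈S ys ++ʷ reverseʷ r a∈S as

-- Vertex removal: if a slim vertex w ≠ x reaches every slim neighbour of x
-- without passing through x, then removing x keeps the slim graph connected,
-- since each visit of a walk from w to x can be cut out.
slimConnected-remove : ∀ {n} (G : HoffmanGraph n) {x w : Fin n} →
  Slim G w → w ≢ x →
  (∀ z → Adj G x z → Slim G z → SlimReach G (∁ ⁅ x ⁆) w z) →
  SlimConnected G ⊤ → SlimConnected G (∁ ⁅ x ⁆)
slimConnected-remove G {x} {w} ws w≢x detour connected a b a∈ as b∈ bs =
  _++ʷ_ G (reverseʷ G (avoid (connected w a ∈⊤ ws ∈⊤ as) (∈∁⁅⁆⇒≢ a∈)) (∈∁⁅⁆ w≢x) ws)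
          (avoid (connected w b ∈⊤ ws ∈⊤ bs) (∈∁⁅⁆⇒≢ b∈))
  where
  avoid : ∀ {z} → SlimReach G ⊤ w z → z ≢ x → SlimReach G (∁ ⁅ x ⁆) w z
  avoid here _ = here
  avoid (step {y} r yz _ zs) z≢x with y ≟ x
  ... | yes refl = detour _ yz zs
  ... | no y≢x = step (avoid r y≢x) yz (∈∁⁅⁆ z≢x) zs

module HoffmanSum {n} (G : HoffmanGraph n) {N0 N1 : Subset n}
  (cover : ∀ x → x ∈ ⊤ → x ∈ N0 ⊎ x ∈ N1)
  (slim-disjoint : ∀ x → Slim G x → x ∈ N0 → x ∉ N1)
  (fat-closed₀ : ∀ x → x ∈ N0 → Slim G x → ∀ y → FatNbr G ⊤ x y → y ∈ N0)
  (cross-pairs : ∀ x y → x ∈ N0 → Slim G x → y ∈ N1 → Slim G y →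
     (∣ commonFat G ⊤ x y ∣ ≤ 1) × (∣ commonFat G ⊤ x y ∣ ≡ 1 ⇔ Adj G x y))
  where

  crossing-edge : ∀ {a b} → SlimReach G ⊤ a b → a ∈ N0 → Slim G a → b ∈ N1 →
    ∃ λ u → ∃ λ v → u ∈ N0 × Slim G u × v ∈ N1 × Slim G v × Adj G u v
  crossing-edge here a∈N0 as a∈N1 = ⊥-elim (slim-disjoint _ as a∈N0 a∈N1)
  crossing-edge (step {y} {z} r yz _ zs) a∈N0 as z∈N1 with cover y ∈⊤
  ... | inj₁ y∈N0 = y , z , y∈N0 , ys , z∈N1 , zs , yz
    where
    ys : Slim G y
    ys with walk-end G r ∈⊤ as
    ... | _ , slim = slim
  ... | inj₂ y∈N1 = crossing-edge r a∈N0 as y∈N1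

  shared-fat : ∀ {u v} → u ∈ N0 → Slim G u → v ∈ N1 → Slim G v → Adj G u v →
    ∃ λ z → z ∈ N0 × Fat G z × Adj G v z
  shared-fat {u} {v} u∈N0 us v∈N1 vs uv =
    let _ , one⇔adj = cross-pairs u v u∈N0 us v∈N1 vs
        z , z∈      = 1≤∣p∣⇒nonempty (≤-reflexive (sym (from one⇔adj uv)))
        fz , uz , vz = commonFat⁻ G z∈
    in z , fat-closed₀ u u∈N0 us z (∈⊤ , fz , uz) , fz , vz

  -- Conversely, slim vertices across the sum with a common fat neighbour
  -- are adjacent, since they have at most one.
  fat-shared⇒adjacent : ∀ {u v z} → u ∈ N0 → Slim G u → v ∈ N1 → Slim G v →
    Fat G z → Adj G u z → Adj G v z → Adj G u v
  fat-shared⇒adjacent {u} {v} u∈N0 us v∈N1 vs fz uz vz =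
    let ≤1 , one⇔adj = cross-pairs u v u∈N0 us v∈N1 vs
    in to one⇔adj (≤-antisym ≤1 (∈⇒1≤∣p∣ (commonFat⁺ G ∈⊤ fz uz vz)))

  module SingleFat (fat₀ : IsFat G N0) (one-fat₀ : ∣ fatSet G N0 ∣ ≡ 1) where

    transfer : ∀ {u u' v} → u ∈ N0 → Slim G u → u' ∈ N0 → Slim G u' →
      v ∈ N1 → Slim G v → Adj G u v → Adj G u' v
    transfer {u' = u'} {v} u∈N0 us u'∈N0 u's v∈N1 vs uv =
      let z , z∈N0 , fz , vz        = shared-fat u∈N0 us v∈N1 vs uv
          z' , z'∈N0 , fz' , u'z'   = fat₀ u' u'∈N0 u's
          z≡z' = ∣p∣≡1⇒unique one-fat₀ (fatSet⁺ G z∈N0 fz) (fatSet⁺ G z'∈N0 fz')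
      in fat-shared⇒adjacent u'∈N0 u's v∈N1 vs fz' u'z' (subst (Adj G v) z≡z' vz)

    neighbour-across : SlimConnected G ⊤ → ∀ {x y} → x ∈ N0 → Slim G x →
      y ∈ N1 → Slim G y → ∃ λ w → w ∈ N1 × Slim G w × Adj G x w
    neighbour-across connected {x} {y} x∈N0 xs y∈N1 ys
      with crossing-edge (connected x y ∈⊤ xs ∈⊤ ys) x∈N0 xs y∈N1
    ... | u , w , u∈N0 , us , w∈N1 , ws , uw =
      w , w∈N1 , ws , transfer u∈N0 us x∈N0 xs w∈N1 ws uw

    -- The witness for the removal
    -- lemma is the slim neighbour w ∈ 𝔫¹ of x, which sees all of 𝔫⁰.
    remove-from-N0 : SlimConnected G ⊤ → 2 ≤ ∣ slimSet G N0 ∣ →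
      (∃ λ y → y ∈ N1 × Slim G y) →
      ∀ {x} → x ∈ N0 → Slim G x → SlimConnected G (∁ ⁅ x ⁆)
    remove-from-N0 connected two-slim₀ (y , y∈N1 , ys) {x} x∈N0 xs
      with neighbour-across connected x∈N0 xs y∈N1 ys | 2≤∣p∣⇒another two-slim₀ x
    ... | w , w∈N1 , ws , xw | x' , x'∈ , x'≢x
      with slimSet⁻ G x'∈
    ... | x'∈N0 , x's = slimConnected-remove G ws w≢x detour connected
      where
      w≢x : w ≢ x
      w≢x refl = slim-disjoint x xs x∈N0 w∈N1

      w~N0 : ∀ {u} → u ∈ N0 → Slim G u → Adj G w u
      w~N0 u∈N0 us = Adj-sym G (transfer x∈N0 xs u∈N0 us w∈N1 ws xw)

      detour : ∀ z → Adj G x z → Slim G z → SlimReach G (∁ ⁅ x ⁆) w z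
      detour z xz zs with cover z ∈⊤
      ... | inj₁ z∈N0 = step here (w~N0 z∈N0 zs) (∈∁⁅⁆ (Adj⇒≢ G xz)) zs
      ... | inj₂ z∈N1 =
        step (step here (w~N0 x'∈N0 x's) (∈∁⁅⁆ x'≢x) x's)
             (transfer x∈N0 xs x'∈N0 x's z∈N1 zs xz) (∈∁⁅⁆ (Adj⇒≢ G xz)) zs

lemma3p7 : ∀ {n} (G : HoffmanGraph n) (N0 N1 : Subset n) →
    IsSum G ⊤ N0 N1 →
    In𝒪 G N0 → ¬ Iso G N0 h2 ⊤ →
    NonEmpty G N1 →
    SlimConnected G ⊤ →
    ∀ x → x ∈ N0 → Slim G x →
    SlimConnected G (∁ ⁅ x ⁆)
lemma3p7 G N0 N1 _ (inj₁ iso) not-h2 _ _ _ _ _ = ⊥-elim (not-h2 iso)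
lemma3p7 G N0 N1 (_ , hoffman₁ , _ , _ , cover , disjoint , closed₀ , _ , cross-pairs)
         (inj₂ (_ , fat₀ , two-slim₀ , one-fat₀)) _ nonempty₁ connected x =
  HoffmanSum.SingleFat.remove-from-N0 G cover disjoint closed₀ cross-pairs
    fat₀ one-fat₀ connected two-slim₀ (slim-member G hoffman₁ nonempty₁)
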